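{- Let $H \geq 2$ and $n \geq 2$ be integers, and let $m_{i,j} \in \mathbf{Z}$ for all $i = 1,\ldots,n-1$ and $j = 1,\ldots,H$. Then there exist nonnegative integers $\ell_{i,j} \in \mathbf{N}_0$ for all $i = 1,\ldots,n$ and $j = 1,\ldots,H$ such that \[ \sum_{r=h}^H (r-h+1)\left(\ell_{i+1,r} - \ell_{i,r}\right) = m_{i,h} \] for all $i = 1,\ldots,n-1$ and $h = 1,\ldots,H$.
   Context: $\mathbf{N}_0 = \{0,1,2,\ldots\}$. -}

module Defs where

open import Data.Nat using (ℕ; zero; suc; _∸_)
open import Data.Integer using (ℤ; +_; _+_; _-_; _*_; 0ℤ)

sumFrom : ℕ → ℕ → (ℕ → ℤ) → ℤ
sumFrom a zero    f = 0ℤ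
sumFrom a (suc k) f = f a + sumFrom (suc a) k f

-- Σ_{r = h}^{H} f r   (empty if h > H)
sumRange : ℕ → ℕ → (ℕ → ℤ) → ℤ
sumRange h H f = sumFrom h (suc H ∸ h) f

lhs : (H : ℕ) → (ℕ → ℕ → ℕ) → ℕ → ℕ → ℤ
lhs H ℓ i h = sumRange h H (λ r → + (suc r ∸ h) * (+ ℓ (suc i) r - + ℓ i r))

-- Extend each row m i by zero beyond H and take second differences
-- d i r = m i r - 2 m i (r+1) + m i (r+2). Summing by parts twice,
-- Σ_{r=h}^{H} (r - h + 1) d i r telescopes to m i h, so it suffices to find
-- ℓ ≥ 0 with ℓ (i+1) r - ℓ i r = d i r. Any integer sequence of differences
-- d 1, …, d (n-1) is realised by naturals: let ℓ i be the sum of the positive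
-- parts of the d j with j < i plus the negative parts of the d j with i ≤ j < n.
module Submission where

open import Defs
open import Data.Nat using (ℕ; zero; suc; _≤_; _<_; _∸_)
import Data.Nat as ℕ
import Data.Nat.Properties as ℕ
open import Data.Integer using (ℤ; +_; -[1+_]; _+_; _-_; _*_; 0ℤ)
import Data.Integer.Properties as ℤ
open import Data.Integer.Tactic.RingSolver using (solve-∀)
open import Data.Product using (∃; _,_; proj₁; proj₂)
open import Relation.Binary.PropositionalEquality
  using (_≡_; refl; sym; trans; cong; cong₂; module ≡-Reasoning)
open import Relation.Nullary using (yes; no; contradiction)

open ≡-Reasoning

positivePart : ℤ → ℕ
positivePart (+ a)    = a
positivePart -[1+ a ] = 0

negativePart : ℤ → ℕ
negativePart (+ a)    = 0
negativePart -[1+ a ] = suc a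

positivePart-negativePart : ∀ z → + positivePart z - + negativePart z ≡ z
positivePart-negativePart (+ a)    = ℤ.+-identityʳ (+ a)
positivePart-negativePart -[1+ a ] = refl

sumFrom-cong : ∀ a k {f g : ℕ → ℤ} → (∀ r → f r ≡ g r) → sumFrom a k f ≡ sumFrom a k g
sumFrom-cong a zero    f≗g = refl
sumFrom-cong a (suc k) f≗g = cong₂ _+_ (f≗g a) (sumFrom-cong (suc a) k f≗g)

module NonNegativeWithDifferences (d : ℕ → ℤ) (n : ℕ) where

  positivePartsBelow : ℕ → ℕ
  positivePartsBelow zero    = 0
  positivePartsBelow (suc i) = positivePartsBelow i ℕ.+ positivePart (d i)

  negativePartsFrom : ℕ → ℕ → ℕ
  negativePartsFrom i zero    = 0
  negativePartsFrom i (suc k) = negativePart (d i) ℕ.+ negativePartsFrom (suc i) k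

  ℓ : ℕ → ℕ
  ℓ i = positivePartsBelow i ℕ.+ negativePartsFrom i (n ∸ i)

  ℓ-unfoldNegativePart : ∀ i → i < n →
    ℓ i ≡ positivePartsBelow i ℕ.+ (negativePart (d i) ℕ.+ negativePartsFrom (suc i) (n ∸ suc i))
  ℓ-unfoldNegativePart i i<n = cong (λ k → positivePartsBelow i ℕ.+ negativePartsFrom i k) (ℕ.+-∸-assoc 1 i<n)

  ℓ-differences : ∀ i → i < n → + ℓ (suc i) - + ℓ i ≡ d i
  ℓ-differences i i<n = begin
    + ℓ (suc i) - + ℓ i
      ≡⟨ cong (λ x → + ℓ (suc i) - + x) (ℓ-unfoldNegativePart i i<n) ⟩
    + (A ℕ.+ p ℕ.+ F) - + (A ℕ.+ (q ℕ.+ F))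
      ≡⟨ cong₂ _-_ (trans (ℤ.pos-+ (A ℕ.+ p) F) (cong (_+ + F) (ℤ.pos-+ A p)))
                   (trans (ℤ.pos-+ A (q ℕ.+ F)) (cong (_+_ (+ A)) (ℤ.pos-+ q F))) ⟩
    (+ A + + p + + F) - (+ A + (+ q + + F))
      ≡⟨ cancel (+ A) (+ p) (+ q) (+ F) ⟩
    + p - + q
      ≡⟨ positivePart-negativePart (d i) ⟩
    d i ∎
    where
    A p q F : ℕ
    A = positivePartsBelow i
    p = positivePart (d i)
    q = negativePart (d i)
    F = negativePartsFrom (suc i) (n ∸ suc i)
    cancel : ∀ (a x y f : ℤ) → (a + x + f) - (a + (y + f)) ≡ x - y
    cancel = solve-∀

nonNegative-withDifferences : (d : ℕ → ℤ) (n : ℕ) →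
  ∃ λ (ℓ : ℕ → ℕ) → ∀ i → i < n → + ℓ (suc i) - + ℓ i ≡ d i
nonNegative-withDifferences d n = ℓ , ℓ-differences
  where open NonNegativeWithDifferences d n

secondDifference : (ℕ → ℤ) → ℕ → ℤ
secondDifference M r = M r - + 2 * M (suc r) + M (suc (suc r))

module _ (M : ℕ → ℤ) (N : ℕ) (vanishes : ∀ r → N ≤ r → M r ≡ 0ℤ) where

  weightedTail-secondDifference : ∀ h j k → h ≤ j → j ℕ.+ k ≡ N →
    sumFrom j k (λ r → + (suc r ∸ h) * secondDifference M r)
      ≡ + (suc j ∸ h) * (M j - M (suc j)) + M (suc j)
  weightedTail-secondDifference h j zero h≤j j+0≡N = sym (begin
    + (suc j ∸ h) * (M j - M (suc j)) + M (suc j)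
      ≡⟨ cong₂ (λ a b → + (suc j ∸ h) * (a - b) + b) (vanishes j N≤j) (vanishes (suc j) (ℕ.m≤n⇒m≤1+n N≤j)) ⟩
    + (suc j ∸ h) * (0ℤ - 0ℤ) + 0ℤ
      ≡⟨ ℤ.+-identityʳ _ ⟩
    + (suc j ∸ h) * 0ℤ
      ≡⟨ ℤ.*-zeroʳ (+ (suc j ∸ h)) ⟩
    0ℤ ∎)
    where
    N≤j : N ≤ j
    N≤j = ℕ.≤-reflexive (trans (sym j+0≡N) (ℕ.+-identityʳ j))
  weightedTail-secondDifference h j (suc k) h≤j j+1+k≡N = begin
    + w * secondDifference M j + sumFrom (suc j) k (λ r → + (suc r ∸ h) * secondDifference M r)
      ≡⟨ cong (_+_ (+ w * secondDifference M j))
              (weightedTail-secondDifference h (suc j) k (ℕ.m≤n⇒m≤1+n h≤j) (trans (sym (ℕ.+-suc j k)) j+1+k≡N)) ⟩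
    + w * secondDifference M j + (+ (suc (suc j) ∸ h) * (M (suc j) - M (suc (suc j))) + M (suc (suc j)))
      ≡⟨ cong (λ v → + w * secondDifference M j + (v * (M (suc j) - M (suc (suc j))) + M (suc (suc j))))
              (trans (cong +_ (ℕ.+-∸-assoc 1 (ℕ.m≤n⇒m≤1+n h≤j))) (ℤ.pos-+ 1 w)) ⟩
    + w * secondDifference M j + ((+ 1 + + w) * (M (suc j) - M (suc (suc j))) + M (suc (suc j)))
      ≡⟨ summationByParts (+ w) (M j) (M (suc j)) (M (suc (suc j))) ⟩
    + w * (M j - M (suc j)) + M (suc j) ∎
    where
    w : ℕ
    w = suc j ∸ h
    summationByParts : ∀ (x a b c : ℤ) →
      x * (a - + 2 * b + c) + ((+ 1 + x) * (b - c) + c) ≡ x * (a - b) + b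
    summationByParts = solve-∀

  weightedSum-secondDifference : ∀ h k → h ℕ.+ k ≡ N →
    sumFrom h k (λ r → + (suc r ∸ h) * secondDifference M r) ≡ M h
  weightedSum-secondDifference h k h+k≡N = begin
    sumFrom h k (λ r → + (suc r ∸ h) * secondDifference M r)
      ≡⟨ weightedTail-secondDifference h h k ℕ.≤-refl h+k≡N ⟩
    + (suc h ∸ h) * (M h - M (suc h)) + M (suc h)
      ≡⟨ cong (λ x → + x * (M h - M (suc h)) + M (suc h)) (ℕ.m+n∸n≡m 1 h) ⟩
    + 1 * (M h - M (suc h)) + M (suc h)
      ≡⟨ unitWeight (M h) (M (suc h)) ⟩
    M h ∎
    where
    unitWeight : ∀ (a b : ℤ) → + 1 * (a - b) + b ≡ a
    unitWeight = solve-∀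

zeroBeyond : ℕ → (ℕ → ℤ) → ℕ → ℤ
zeroBeyond H f r with r ℕ.≤? H
... | yes _ = f r
... | no  _ = 0ℤ

zeroBeyond-≤ : ∀ H f r → r ≤ H → zeroBeyond H f r ≡ f r
zeroBeyond-≤ H f r r≤H with r ℕ.≤? H
... | yes _   = refl
... | no  r≰H = contradiction r≤H r≰H

zeroBeyond-> : ∀ H f r → H < r → zeroBeyond H f r ≡ 0ℤ
zeroBeyond-> H f r H<r with r ℕ.≤? H
... | yes r≤H = contradiction r≤H (ℕ.<⇒≱ H<r)
... | no  _   = refl

lemma5 : (H n : ℕ) → 2 ≤ H → 2 ≤ n → (m : ℕ → ℕ → ℤ) →
    ∃ λ (ℓ : ℕ → ℕ → ℕ) →
    (i h : ℕ) → 1 ≤ i → i < n → 1 ≤ h → h ≤ H → lhs H ℓ i h ≡ m i h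
lemma5 H n _ _ m = ℓ , solves
  where
  M : ℕ → ℕ → ℤ
  M i = zeroBeyond H (m i)

  realisation : ∀ r → ∃ λ (ℓʳ : ℕ → ℕ) → ∀ i → i < n → + ℓʳ (suc i) - + ℓʳ i ≡ secondDifference (M i) r
  realisation r = nonNegative-withDifferences (λ i → secondDifference (M i) r) n

  ℓ : ℕ → ℕ → ℕ
  ℓ i r = proj₁ (realisation r) i

  solves : ∀ i h → 1 ≤ i → i < n → 1 ≤ h → h ≤ H → lhs H ℓ i h ≡ m i h
  solves i h _ i<n _ h≤H = begin
    lhs H ℓ i h
      ≡⟨ sumFrom-cong h (suc H ∸ h) (λ r → cong (_*_ (+ (suc r ∸ h))) (proj₂ (realisation r) i i<n)) ⟩
    sumFrom h (suc H ∸ h) (λ r → + (suc r ∸ h) * secondDifference (M i) r)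
      ≡⟨ weightedSum-secondDifference (M i) (suc H) (zeroBeyond-> H (m i)) h (suc H ∸ h)
           (ℕ.m+[n∸m]≡n (ℕ.m≤n⇒m≤1+n h≤H)) ⟩
    M i h
      ≡⟨ zeroBeyond-≤ H (m i) h h≤H ⟩
    m i h ∎
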